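{- Let $n\ge 1$ be a natural number and $p$ a propositional variable. Then the sequents $\Rightarrow \neg^{(2n+1)}p\to\neg p$ and $\Rightarrow \neg^{(2n)}p\leftrightarrow\neg\neg p$ are derivable in the sequent calculus $\mathbf{G3}_{\mathsf{CoPC}}$ (equivalently, in $\mathbf{G3}_{\mathsf{CoPC}}$ extended with the weakening, contraction and cut rules).
   Context: Formulas are built from a countable set of propositional variables and the constant $\top$ (no $\bot$) using binary $\land,\lor,\to$ and unary $\neg$; $\neg^{(m)}\varphi$ denotes $\varphi$ preceded by $m$ negation symbols, and $\varphi\leftrightarrow\psi$ abbreviates $(\varphi\to\psi)\land(\psi\to\varphi)$. A sequent is $\Gamma\Rightarrow\varphi$ with $\Gamma$ a finite multiset of formulas. $\mathbf{G3}_{\mathsf{CoPC}}$ has the rules: (ax) $\Gamma,p\Rightarrow p$ for a propositional variable $p$; ($\top$) $\Gamma\Rightarrow\top$; ($\to$r) from $\Gamma,\alpha\Rightarrow\beta$ infer $\Gamma\Rightarrow\alpha\to\beta$; ($\to$l) from $\Gamma,\alpha\to\beta\Rightarrow\alpha$ and $\Gamma,\beta\Rightarrow\varphi$ infer $\Gamma,\alpha\to\beta\Rightarrow\varphi$; ($\land$r) from $\Gamma\Rightarrow\alpha$ and $\Gamma\Rightarrow\beta$ infer $\Gamma\Rightarrow\alpha\land\beta$; ($\land$l) from $\Gamma,\alpha,\beta\Rightarrow\varphi$ infer $\Gamma,\alpha\land\beta\Rightarrow\varphi$; ($\lor$r$_1$), ($\lor$r$_2$) from $\Gamma\Rightarrow\alpha$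 (resp. $\Gamma\Rightarrow\beta$) infer $\Gamma\Rightarrow\alpha\lor\beta$; ($\lor$l) from $\Gamma,\alpha\Rightarrow\varphi$ and $\Gamma,\beta\Rightarrow\varphi$ infer $\Gamma,\alpha\lor\beta\Rightarrow\varphi$; (copc) from $\Gamma,\neg\alpha,\beta\Rightarrow\alpha$ infer $\Gamma,\neg\alpha\Rightarrow\neg\beta$. Weakening: from $\Gamma\Rightarrow\varphi$ infer $\Gamma,\alpha\Rightarrow\varphi$; contraction: from $\Gamma,\alpha,\alpha\Rightarrow\varphi$ infer $\Gamma,\alpha\Rightarrow\varphi$; cut: from $\Gamma\Rightarrow\alpha$ and $\Delta,\alpha\Rightarrow\varphi$ infer $\Gamma,\Delta\Rightarrow\varphi$. -}

module Defs where

open import Data.Nat using (ℕ; zero; suc)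
open import Data.List using (List; []; _∷_)
open import Data.List.Relation.Binary.Permutation.Propositional using (_↭_)

data Fm : Set where
  var  : ℕ → Fm
  ⊤'   : Fm
  _∧'_ : Fm → Fm → Fm
  _∨'_ : Fm → Fm → Fm
  _⇒'_ : Fm → Fm → Fm
  ¬'_  : Fm → Fm

infixr 6 _∧'_
infixr 5 _∨'_
infixr 4 _⇒'_
infix 3 _⇔'_
infix 8 ¬'_

negs : ℕ → Fm → Fm
negs zero    φ = φ
negs (suc m) φ = ¬' (negs m φ)

_⇔'_ : Fm → Fm → Fm
φ ⇔' ψ = (φ ⇒' ψ) ∧' (ψ ⇒' φ)

-- Contexts are finite multisets, represented as lists taken up to permutation
-- (rule `perm`).  Principal formulas are written at the head of the list.
Ctx : Set
Ctx = List Fm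

data G3 : Ctx → Fm → Set where
  perm : ∀ {Γ Δ φ} → Γ ↭ Δ → G3 Γ φ → G3 Δ φ
  ax   : ∀ {Γ p} → G3 (var p ∷ Γ) (var p)
  top  : ∀ {Γ} → G3 Γ ⊤'
  →r   : ∀ {Γ α β} → G3 (α ∷ Γ) β → G3 Γ (α ⇒' β)
  →l   : ∀ {Γ α β φ} → G3 ((α ⇒' β) ∷ Γ) α → G3 (β ∷ Γ) φ
       → G3 ((α ⇒' β) ∷ Γ) φ
  ∧r   : ∀ {Γ α β} → G3 Γ α → G3 Γ β → G3 Γ (α ∧' β)
  ∧l   : ∀ {Γ α β φ} → G3 (α ∷ β ∷ Γ) φ → G3 ((α ∧' β) ∷ Γ) φ
  ∨r₁  : ∀ {Γ α β} → G3 Γ α → G3 Γ (α ∨' β)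
  ∨r₂  : ∀ {Γ α β} → G3 Γ β → G3 Γ (α ∨' β)
  ∨l   : ∀ {Γ α β φ} → G3 (α ∷ Γ) φ → G3 (β ∷ Γ) φ → G3 ((α ∨' β) ∷ Γ) φ
  copc : ∀ {Γ α β} → G3 ((¬' α) ∷ β ∷ Γ) α → G3 ((¬' α) ∷ Γ) (¬' β)

module Submission where

-- All derivations are built from the primitive rules (ax) and
-- (copc); no structural rule is needed.  Since contexts are multisets, both
-- rules may act on a formula anywhere in the context (`ax-at`, `copc-at`).
-- The core is the collapse of double negations (`even-negs-collapse`): if φ
-- is derivable whenever it occurs in the context, then every context that
-- contains both φ and ¬^(2m+1)φ proves ¬^(2m)φ.  Its inductive step is the
-- derived rule `triple-negation`: with ¬¬¬ψ in the context, ¬¬ψ follows from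
-- a derivation of ψ from two further copies of ¬ψ.  The lemma is applied with
-- φ = p and with φ = ¬p, both of which enjoy the identity property.  The
-- three implications of the theorem then each consist of one or two (copc)
-- steps followed by an instance of the collapse lemma; n ≥ 1 is needed only
-- for the biconditional, whose proofs peel two negations off ¬^(2n)p.

open import Defs
open import Data.Nat using (ℕ; zero; suc; _*_; _≥_; s≤s; z≤n)
open import Data.Nat.Properties using (*-suc)
open import Data.List using (List; []; _∷_; _++_)
open import Data.Product using (_×_; _,_; ∃)
open import Data.List.Membership.Propositional using (_∈_)
open import Data.List.Membership.Propositional.Properties using (∈-∃++)
open import Data.List.Relation.Unary.Any using (here; there)
open import Data.List.Relation.Binary.Permutation.Propositional
  using (_↭_; ↭-refl; ↭-sym; ↭-trans; prep; swap)
open import Data.List.Relation.Binary.Permutation.Propositional.Properties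
  using (shift)
open import Relation.Binary.PropositionalEquality using (_≡_; refl; sym; subst; cong)

focus : ∀ {x : Fm} {Γ : List Fm} → x ∈ Γ → ∃ λ Γ' → (x ∷ Γ') ↭ Γ
focus {x} x∈Γ with ys , zs , refl ← ∈-∃++ x∈Γ = ys ++ zs , ↭-sym (shift x ys zs)

ax-at : ∀ {p Γ} → var p ∈ Γ → G3 Γ (var p)
ax-at p∈Γ with Γ' , π ← focus p∈Γ = perm π ax

copc-at : ∀ {α β Γ} → (¬' α) ∈ Γ → G3 (β ∷ Γ) α → G3 Γ (¬' β)
copc-at ¬α∈Γ d with Γ' , π ← focus ¬α∈Γ =
  perm π (copc (perm (↭-trans (prep _ (↭-sym π)) (swap _ _ ↭-refl)) d))

Identity : Fm → Set
Identity φ = ∀ {Γ} → φ ∈ Γ → G3 Γ φ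

var-identity : ∀ p → Identity (var p)
var-identity p = ax-at

neg-identity : ∀ {φ} → Identity φ → Identity (¬' φ)
neg-identity id-φ ¬φ∈Γ = copc-at ¬φ∈Γ (id-φ (here refl))

triple-negation : ∀ {ψ Γ} → (¬' ¬' ¬' ψ) ∈ Γ
  → G3 (¬' ψ ∷ ¬' ψ ∷ Γ) ψ → G3 Γ (¬' ¬' ψ)
triple-negation h d = copc-at h (copc-at (here refl) d)

negs-¬ : ∀ m φ → negs m (¬' φ) ≡ negs (suc m) φ
negs-¬ zero    φ = refl
negs-¬ (suc m) φ rewrite negs-¬ m φ = refl

negs-twice-suc : ∀ m φ → negs (2 * suc m) φ ≡ ¬' ¬' negs (2 * m) φ
negs-twice-suc m φ = cong (λ j → negs j φ) (*-suc 2 m)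

even-negs-collapse : ∀ {φ} → Identity φ → ∀ m {Γ} → φ ∈ Γ
  → negs (suc (2 * m)) φ ∈ Γ → G3 Γ (negs (2 * m) φ)
even-negs-collapse id-φ zero    φ∈Γ _ = id-φ φ∈Γ
even-negs-collapse {φ} id-φ (suc m) {Γ} φ∈Γ h =
  subst (G3 Γ) (sym (negs-twice-suc m φ))
    (triple-negation (subst (_∈ Γ) (cong ¬'_ (negs-twice-suc m φ)) h)
      (even-negs-collapse id-φ m (there (there φ∈Γ)) (here refl)))

proposition4p2 : (n : ℕ) → n ≥ 1 → (p : ℕ)
    → G3 [] (negs (suc (2 * n)) (var p) ⇒' ¬' (var p))
    × G3 [] (negs (2 * n) (var p) ⇔' ¬' ¬' (var p))
proposition4p2 (suc k) (s≤s z≤n) p = odd⇒¬p , ∧r even⇒¬¬p ¬¬p⇒even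
  where
  P : Fm
  P = var p

  n : ℕ
  n = suc k

  -- ¬^(2n+1)p ⊢ ¬p: contrapose, then collapse p, ¬^(2n+1)p ⊢ ¬^(2n)p.
  odd⇒¬p : G3 [] (negs (suc (2 * n)) P ⇒' ¬' P)
  odd⇒¬p = →r (copc-at (here refl)
    (even-negs-collapse (var-identity p) n (here refl) (there (here refl))))

  -- ¬^(2n)p ⊢ ¬¬p: contrapose, then collapse ¬p, ¬^(2k+1)(¬p) ⊢ ¬^(2k)(¬p).
  even⇒¬¬p : G3 [] (negs (2 * n) P ⇒' ¬' ¬' P)
  even⇒¬¬p = subst (λ χ → G3 [] (χ ⇒' ¬' ¬' P)) (sym (negs-twice-suc k P))
    (→r (copc-at (here refl)
      (subst (G3 _) (negs-¬ (2 * k) P)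
        (even-negs-collapse (neg-identity (var-identity p)) k (here refl)
          (there (here (negs-¬ (suc (2 * k)) P)))))))

  -- ¬¬p ⊢ ¬^(2n)p: contrapose twice, then collapse p, ¬^(2k+1)p ⊢ ¬^(2k)p.
  ¬¬p⇒even : G3 [] (¬' ¬' P ⇒' negs (2 * n) P)
  ¬¬p⇒even = subst (λ χ → G3 [] (¬' ¬' P ⇒' χ)) (sym (negs-twice-suc k P))
    (→r (copc-at (here refl) (copc-at (here refl)
      (even-negs-collapse (var-identity p) k (here refl) (there (here refl))))))
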